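{- Let $L=\mathrm{Log}(\mathcal F_L)$ be a tabular quasi-normal modal logic where $\mathcal F_L=\{(\mathfrak F_1,0),\dots,(\mathfrak F_n,0)\}$ is a reduced set of finite rooted frames. Then the following are equivalent: (1) $L$ has the Craig interpolation property; (2) for every signature $\sigma$: whenever $\mathfrak M,0\sim_\sigma\mathfrak N,0$ with $\mathfrak M$ a model based on $\mathfrak F_i$ and $\mathfrak N$ a model based on $\mathfrak F_j$, the $\sigma$-reducts of $(\mathfrak M,0)$ and $(\mathfrak N,0)$ are isomorphic (in particular $i=j$).
   Context: Modal formulas over atoms with $\top,\neg,\wedge,\Box$; $\mathrm{sig}$ = set of atoms; a signature is a finite set of atoms. A frame $(W,R)$ is rooted at $0$ if every world is $R$-reachable from $0$. $\mathrm{Log}(\mathcal F)$ for a set of pointed frames is the set of formulas valid at the distinguished world under all valuations. Quasi-normal modal logic: set of modal formulas containing all formulas valid in all pointed frames, closed under modus ponens and uniform substitution; tabular if it is $\mathrm{Log}$ of a finite set of finite pointed frames. $\mathcal F_L$ is reduced if $\mathrm{Log}(\mathfrak F_i,0)\not\subseteq\mathrm{Log}(\mathfrak F_j,0)$ for $i\neq j$. $L$ has the Craig interpolation property if for all $\varphi\to\psi\in L$ there is $\chi$ with $\varphi\to\chi\in L$, $\chi\to\psi\in L$, $\mathrm{sig}(\chi)\subseteq\mathrm{sig}(\varphi)\cap\mathrm{sig}(\psi)$. A $\sigma$-bisimulation between models $\mathfrak M_1,\mathfrak M_2$ is a relation $Z\subseteq W_1\times W_2$ such that related worlds agree on all atoms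 in $\sigma$, and (forth) if $w_1Zw_2$ and $w_1R_1v_1$ then there is $v_2$ with $w_2R_2v_2$ and $v_1Zv_2$, and (back) symmetrically; $\mathfrak M_1,w_1\sim_\sigma\mathfrak M_2,w_2$ means some $\sigma$-bisimulation relates $w_1$ and $w_2$. An isomorphism between the $\sigma$-reducts of pointed models $(\mathfrak M_1,w_1)$ and $(\mathfrak M_2,w_2)$ is a frame isomorphism $f$ with $f(w_1)=w_2$ such that $\mathfrak M_1,w\models p$ iff $\mathfrak M_2,f(w)\models p$ for all worlds $w$ and all $p\in\sigma$. -}

module Defs where

open import Data.Nat using (ℕ; suc)
open import Data.Fin using (Fin; zero)
open import Data.Bool using (Bool; true)
open import Data.List using (List)
open import Data.List.Membership.Propositional using (_∈_)
open import Data.Product using (Σ; _×_; ∃)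
open import Data.Sum using (_⊎_)
open import Data.Unit using (⊤)
open import Data.Empty using (⊥)
open import Relation.Nullary using (¬_)
open import Relation.Binary.PropositionalEquality using (_≡_)
open import Relation.Binary.Construct.Closure.ReflexiveTransitive using (Star)
open import Function.Bundles using (Bijection; _⤖_)

data Fm : Set where
  var  : ℕ → Fm
  top  : Fm
  neg  : Fm → Fm
  conj : Fm → Fm → Fm
  box  : Fm → Fm

_⇒_ : Fm → Fm → Fm
φ ⇒ ψ = neg (conj φ (neg ψ))

data Occurs (p : ℕ) : Fm → Set where
  here  : Occurs p (var p)
  neg′  : ∀ {φ} → Occurs p φ → Occurs p (neg φ)
  conjˡ : ∀ {φ ψ} → Occurs p φ → Occurs p (conj φ ψ)
  conjʳ : ∀ {φ ψ} → Occurs p ψ → Occurs p (conj φ ψ)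
  box′  : ∀ {φ} → Occurs p φ → Occurs p (box φ)

record Frame : Set where
  field
    size   : ℕ
    R      : Fin (suc size) → Fin (suc size) → Bool
    rooted : ∀ w → Star (λ u v → R u v ≡ true) zero w

open Frame public

World : Frame → Set
World F = Fin (suc (size F))

-- A model based on F is given by a valuation of all atoms.
Valuation : Frame → Set
Valuation F = World F → ℕ → Bool

sat : (F : Frame) → Valuation F → World F → Fm → Set
sat F V w (var p)    = V w p ≡ true
sat F V w top        = ⊤
sat F V w (neg φ)    = ¬ sat F V w φ
sat F V w (conj φ ψ) = sat F V w φ × sat F V w ψ
sat F V w (box φ)    = ∀ v → R F w v ≡ true → sat F V v φ

Log : {n : ℕ} → (Fin n → Frame) → Fm → Set
Log Fs φ = ∀ i (V : Valuation (Fs i)) → sat (Fs i) V zero φ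

Log₁ : Frame → Fm → Set
Log₁ F φ = ∀ (V : Valuation F) → sat F V zero φ

Reduced : {n : ℕ} → (Fin n → Frame) → Set
Reduced {n} Fs = ∀ (i j : Fin n) → ¬ (i ≡ j) →
  ¬ (∀ φ → Log₁ (Fs i) φ → Log₁ (Fs j) φ)

CIP : (Fm → Set) → Set
CIP L = ∀ φ ψ → L (φ ⇒ ψ) →
  Σ Fm λ χ → L (φ ⇒ χ) × L (χ ⇒ ψ) ×
    (∀ p → Occurs p χ → Occurs p φ × Occurs p ψ)

record IsBisim (σ : List ℕ) (F₁ : Frame) (V₁ : Valuation F₁)
               (F₂ : Frame) (V₂ : Valuation F₂)
               (Z : World F₁ → World F₂ → Set) : Set where
  field
    atoms : ∀ {w₁ w₂} → Z w₁ w₂ → ∀ p → p ∈ σ → V₁ w₁ p ≡ V₂ w₂ p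
    forth : ∀ {w₁ w₂ v₁} → Z w₁ w₂ → R F₁ w₁ v₁ ≡ true →
              Σ (World F₂) λ v₂ → R F₂ w₂ v₂ ≡ true × Z v₁ v₂
    back  : ∀ {w₁ w₂ v₂} → Z w₁ w₂ → R F₂ w₂ v₂ ≡ true →
              Σ (World F₁) λ v₁ → R F₁ w₁ v₁ ≡ true × Z v₁ v₂

Bisimilar : (σ : List ℕ) (F₁ : Frame) (V₁ : Valuation F₁) (w₁ : World F₁)
            (F₂ : Frame) (V₂ : Valuation F₂) (w₂ : World F₂) → Set₁
Bisimilar σ F₁ V₁ w₁ F₂ V₂ w₂ =
  Σ (World F₁ → World F₂ → Set) λ Z → IsBisim σ F₁ V₁ F₂ V₂ Z × Z w₁ w₂

record ReductIso (σ : List ℕ) (F₁ : Frame) (V₁ : Valuation F₁) (w₁ : World F₁)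
                 (F₂ : Frame) (V₂ : Valuation F₂) (w₂ : World F₂) : Set where
  field
    f      : World F₁ ⤖ World F₂
    point  : Bijection.to f w₁ ≡ w₂
    rel    : ∀ u v → R F₁ u v ≡ R F₂ (Bijection.to f u) (Bijection.to f v)
    atoms  : ∀ w p → p ∈ σ → V₁ w p ≡ V₂ (Bijection.to f w) p

Condition2 : {n : ℕ} → (Fin n → Frame) → Set₁
Condition2 Fs = ∀ (σ : List ℕ) i j (V : Valuation (Fs i)) (U : Valuation (Fs j)) →
  Bisimilar σ (Fs i) V zero (Fs j) U zero →
  ReductIso σ (Fs i) V zero (Fs j) U zero

{-# OPTIONS --safe #-}
-- (1) ⇒ (2). Name every world of 𝔉ᵢ and 𝔉ⱼ by a fresh atom and let Δ_M, Δ_N be the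
-- diagrams of (𝔉ᵢ, V) and (𝔉ⱼ, U): each world satisfies exactly one name, the σ-type and the
-- successors of the world it names, and this is boxed deep enough to reach every world of
-- every frame of L. A model of Δ_M ∧ Δ_N on some 𝔉ₖ maps onto both (𝔉ᵢ, V) and (𝔉ⱼ, U) by
-- root-preserving, σ-preserving p-morphisms. Hence Log(𝔉ₖ) ⊆ Log(𝔉ᵢ) ∩ Log(𝔉ⱼ), so k = i = j
-- because L is reduced, and surjective p-morphisms of a finite frame onto itself are
-- automorphisms, which yields the σ-isomorphism. Such a model exists: otherwise Δ_M → ¬Δ_N ∈ L,
-- and its interpolant, a σ-formula, would hold at the root of (𝔉ᵢ, V) with the names added and
-- then, by σ-bisimilarity, at the root of (𝔉ⱼ, U) with the names added, where Δ_N holds.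
-- Satisfiability in L is decidable (only the values of the finitely many atoms of a formula
-- matter), so this argument by contradiction produces the model.
--
-- (2) ⇒ (1). For φ → ψ ∈ L and σ = sig φ ∩ sig ψ, the interpolant is the disjunction of the
-- σ-characteristic formulas of depth D of all models of φ on frames of L. D bounds the length
-- of any strictly descending chain of bisimulation approximants between two frames of L, so a
-- model of the interpolant is σ-bisimilar, hence by (2) σ-isomorphic, to a model of φ. Moving
-- the values of the atoms outside sig φ across the isomorphism keeps φ true, so ψ holds there
-- too, and ψ is carried back along the isomorphism.

module Submission where

open import Defs
open import Data.Bool using (Bool; true; false)
open import Data.Bool.Properties using (¬-not; not-¬) renaming (_≟_ to _≟ᵇ_)
open import Data.Fin using (Fin; zero; suc; toℕ; join; splitAt; punchOut)
open import Data.Fin.Properties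
  using (any?; all?; toℕ-injective; splitAt-join; punchOut-injective; injective⇒≤)
  renaming (_≟_ to _≟ᶠ_)
open import Data.List
  using (List; []; _∷_; _++_; map; filter; length; allFin; cartesianProduct; cartesianProductWith)
open import Data.List.Properties using (length-filter; length-++; length-map; length-tabulate)
open import Data.List.Extrema.Nat using (max; xs≤max)
open import Data.List.Membership.Propositional using (_∈_; _∉_; find; lose)
open import Data.List.Membership.Propositional.Properties
  using (∈-allFin; ∈-filter⁺; ∈-filter⁻; ∈-map⁺; ∈-++⁺ˡ; ∈-++⁺ʳ; ∈-++⁻;
         ∈-cartesianProductWith⁺; ∈-cartesianProduct⁺)
open import Data.List.Relation.Unary.All as All using (All)
open import Data.List.Relation.Unary.Any as Any using (Any; here; there)
open import Data.Nat using (ℕ; zero; suc; _+_; _*_; _≤_; _<_; z≤n; s≤s)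
open import Data.Nat.Properties
  using (≤-refl; ≤-trans; 1+n≰n; n≤1+n; m≤m+n; m≤n⇒m≤1+n; m<n⇒m<1+n;
         +-suc; +-monoʳ-≤; +-cancelˡ-≡; *-mono-≤; module ≤-Reasoning)
  renaming (_≟_ to _≟ⁿ_)
open import Data.List.Membership.DecPropositional _≟ⁿ_ using (_∈?_)
open import Data.Product using (Σ; ∃-syntax; _×_; _,_; proj₁; proj₂; map₂)
open import Data.Product.Function.NonDependent.Propositional using (_×-⇔_)
open import Data.Sum using (_⊎_; inj₁; inj₂)
open import Data.Sum.Properties using (inj₁-injective; inj₂-injective)
open import Data.Unit using (tt)
open import Function using (_∘_; id; const; _⇔_; mk⇔; Equivalence; Injective; StrictlySurjective;
                            Bijection; mk⤖)
open import Function.Consequences.Propositional using (strictlySurjective⇒surjective)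
open import Function.Construct.Composition using (_⤖-∘_)
open import Function.Construct.Symmetry using (⤖-sym)
open import Function.Related.TypeIsomorphisms using (¬-cong-⇔)
open import Relation.Binary.Definitions using (DecidableEquality)
open import Relation.Binary.PropositionalEquality
  using (_≡_; _≢_; refl; sym; trans; cong; cong₂; subst; module ≡-Reasoning)
open import Relation.Binary.Construct.Closure.ReflexiveTransitive using (Star; ε; _◅_)
open import Relation.Nullary using (¬_; Dec; yes; no; ¬?; contradiction)
open import Relation.Nullary.Decidable using (_×-dec_; _⊎-dec_; _→-dec_; map′; decidable-stable)
open import Relation.Unary using (Pred; Decidable; _⊆_)
open import Level using (0ℓ)

open Equivalence using (to; from)

private variable
  n p : ℕ
  σ : List ℕ
  φ ψ θ : Fm
  A : Set
  F G : Frame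

◇ : Fm → Fm
◇ φ = neg (box (neg φ))

⋀ : List A → (A → Fm) → Fm
⋀ []       f = top
⋀ (x ∷ xs) f = conj (f x) (⋀ xs f)

⋁ : List A → (A → Fm) → Fm
⋁ xs f = neg (⋀ xs (neg ∘ f))

module _ {f : A → Fm} where

  ⋀-occurs : ∀ xs → Occurs p (⋀ xs f) → ∃[ x ] x ∈ xs × Occurs p (f x)
  ⋀-occurs (x ∷ xs) (conjˡ o) = x , here refl , o
  ⋀-occurs (x ∷ xs) (conjʳ o) with ⋀-occurs xs o
  ... | y , y∈ , o′ = y , there y∈ , o′

⋁-occurs : {f : A → Fm} → ∀ xs → Occurs p (⋁ xs f) → ∃[ x ] x ∈ xs × Occurs p (f x)
⋁-occurs {f = f} xs (neg′ o) with ⋀-occurs {f = neg ∘ f} xs o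
... | x , x∈ , neg′ o′ = x , x∈ , o′

□≤ : ℕ → Fm → Fm
□≤ zero    θ = θ
□≤ (suc d) θ = conj θ (box (□≤ d θ))

□≤-occurs : ∀ d → Occurs p (□≤ d θ) → Occurs p θ
□≤-occurs zero    o                 = o
□≤-occurs (suc d) (conjˡ o)         = o
□≤-occurs (suc d) (conjʳ (box′ o))  = □≤-occurs d o

literal : Bool → ℕ → Fm
literal true  p = var p
literal false p = neg (var p)

literal-occurs : ∀ b {q} → Occurs p (literal b q) → p ≡ q
literal-occurs true  here        = refl
literal-occurs false (neg′ here) = refl

atomicType : List ℕ → (ℕ → Bool) → Fm
atomicType σ a = ⋀ σ λ p → literal (a p) p

atomicType-occurs : ∀ {a} → Occurs p (atomicType σ a) → p ∈ σ
atomicType-occurs {σ = σ} {a = a} o =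
  let q , q∈ , o′ = ⋀-occurs σ o in subst (_∈ σ) (sym (literal-occurs (a q) o′)) q∈

sig : Fm → List ℕ
sig (var p)    = p ∷ []
sig top        = []
sig (neg φ)    = sig φ
sig (conj φ ψ) = sig φ ++ sig ψ
sig (box φ)    = sig φ

∈-sig⁺ : Occurs p φ → p ∈ sig φ
∈-sig⁺ here                     = here refl
∈-sig⁺ (neg′ o)                 = ∈-sig⁺ o
∈-sig⁺ (conjˡ o)                = ∈-++⁺ˡ (∈-sig⁺ o)
∈-sig⁺ {φ = conj φ _} (conjʳ o) = ∈-++⁺ʳ (sig φ) (∈-sig⁺ o)
∈-sig⁺ (box′ o)                 = ∈-sig⁺ o

∈-sig⁻ : ∀ φ → p ∈ sig φ → Occurs p φ
∈-sig⁻ (var p)    (here refl) = here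
∈-sig⁻ (neg φ)    p∈          = neg′ (∈-sig⁻ φ p∈)
∈-sig⁻ (conj φ ψ) p∈ with ∈-++⁻ (sig φ) p∈
... | inj₁ p∈φ = conjˡ (∈-sig⁻ φ p∈φ)
... | inj₂ p∈ψ = conjʳ (∈-sig⁻ ψ p∈ψ)
∈-sig⁻ (box φ)    p∈          = box′ (∈-sig⁻ φ p∈)

-- Descending chains of finite subsets

length-cartesianProduct : {B : Set} (xs : List A) (ys : List B) →
                          length (cartesianProduct xs ys) ≡ length xs * length ys
length-cartesianProduct []       ys = refl
length-cartesianProduct (x ∷ xs) ys = begin
  length (map (x ,_) ys ++ cartesianProduct xs ys)          ≡⟨ length-++ (map (x ,_) ys) ⟩
  length (map (x ,_) ys) + length (cartesianProduct xs ys)  ≡⟨ cong₂ _+_ (length-map (x ,_) ys)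
                                                                        (length-cartesianProduct xs ys) ⟩
  length ys + length xs * length ys                         ∎
  where open ≡-Reasoning

module _ {P Q : Pred A 0ℓ} (P? : Decidable P) (Q? : Decidable Q) (P⊆Q : P ⊆ Q) where

  length-filter-mono : ∀ xs → length (filter P? xs) ≤ length (filter Q? xs)
  length-filter-mono []       = z≤n
  length-filter-mono (x ∷ xs) with P? x | Q? x
  ... | yes _  | yes _  = s≤s (length-filter-mono xs)
  ... | yes px | no ¬qx = contradiction (P⊆Q px) ¬qx
  ... | no  _  | yes _  = m≤n⇒m≤1+n (length-filter-mono xs)
  ... | no  _  | no  _  = length-filter-mono xs

  length-filter-strict : ∀ {a} xs → a ∈ xs → Q a → ¬ P a → length (filter P? xs) < length (filter Q? xs)
  length-filter-strict (x ∷ xs) (here refl) qa ¬pa with P? x | Q? x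
  ... | yes pa | _      = contradiction pa ¬pa
  ... | no  _  | yes _  = s≤s (length-filter-mono xs)
  ... | no  _  | no ¬qa = contradiction qa ¬qa
  length-filter-strict (x ∷ xs) (there a∈) qa ¬pa with P? x | Q? x
  ... | yes _  | yes _  = s≤s (length-filter-strict xs a∈ qa ¬pa)
  ... | yes px | no ¬qx = contradiction (P⊆Q px) ¬qx
  ... | no  _  | yes _  = m<n⇒m<1+n (length-filter-strict xs a∈ qa ¬pa)
  ... | no  _  | no  _  = length-filter-strict xs a∈ qa ¬pa

module _ (xs : List A) (xs-complete : ∀ a → a ∈ xs) {P : ℕ → Pred A 0ℓ}
         (P? : ∀ m → Decidable (P m)) (P-descending : ∀ m → P (suc m) ⊆ P m) where

  private
    weight : ℕ → ℕ
    weight m = length (filter (P? m) xs)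

    stable-or-shrinking : ∀ m → P m ⊆ P (suc m) ⊎ weight (suc m) < weight m
    stable-or-shrinking m with Any.any? (λ a → P? m a ×-dec ¬? (P? (suc m) a)) xs
    ... | yes drop = let a , a∈ , pa , ¬pa′ = find drop in
      inj₂ (length-filter-strict (P? (suc m)) (P? m) (P-descending m) xs a∈ pa ¬pa′)
    ... | no ¬drop = inj₁ λ {a} pa →
      decidable-stable (P? (suc m) a) λ ¬pa′ → ¬drop (lose (xs-complete a) (pa , ¬pa′))

    descend : ∀ k → (∃[ m ] m < k × P m ⊆ P (suc m)) ⊎ k + weight k ≤ weight 0
    descend zero = inj₂ ≤-refl
    descend (suc k) with descend k
    ... | inj₁ (m , m<k , stable) = inj₁ (m , m<n⇒m<1+n m<k , stable)
    ... | inj₂ bound with stable-or-shrinking k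
    ...   | inj₁ stable = inj₁ (k , ≤-refl , stable)
    ...   | inj₂ shrink = inj₂ (begin
      suc k + weight (suc k)   ≡⟨ +-suc k (weight (suc k)) ⟨
      k + suc (weight (suc k)) ≤⟨ +-monoʳ-≤ k shrink ⟩
      k + weight k             ≤⟨ bound ⟩
      weight 0                 ∎)
      where open ≤-Reasoning

  descending-chain-stabilises : ∃[ m ] m ≤ length xs × P m ⊆ P (suc m)
  descending-chain-stabilises with descend (suc (length xs))
  ... | inj₁ (m , s≤s m≤len , stable) = m , m≤len , stable
  ... | inj₂ bound = contradiction (≤-trans (m≤m+n _ _) (≤-trans bound (length-filter (P? 0) xs))) 1+n≰n

-- Opaque, so that lists filtered out of it do not unfold and implicit arguments stay inferable.
opaque

  worlds : (F : Frame) → List (World F)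
  worlds F = allFin (suc (size F))

  ∈-worlds : (w : World F) → w ∈ worlds F
  ∈-worlds = ∈-allFin

  length-worlds : ∀ F → length (worlds F) ≡ suc (size F)
  length-worlds F = length-tabulate id

successors : (F : Frame) → World F → List (World F)
successors F w = filter (λ v → R F w v ≟ᵇ true) (worlds F)

module _ {F : Frame} {w v : World F} where

  ∈-successors⁺ : R F w v ≡ true → v ∈ successors F w
  ∈-successors⁺ = ∈-filter⁺ (λ v → R F w v ≟ᵇ true) (∈-worlds {F = F} v)

  ∈-successors⁻ : v ∈ successors F w → R F w v ≡ true
  ∈-successors⁻ = proj₂ ∘ ∈-filter⁻ (λ v → R F w v ≟ᵇ true) {xs = worlds F}

Within : (F : Frame) → ℕ → World F → World F → Set
Within F zero    u w = u ≡ w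
Within F (suc m) u w = u ≡ w ⊎ ∃[ v ] R F u v ≡ true × Within F m v w

module _ {F : Frame} where

  within? : ∀ m u w → Dec (Within F m u w)
  within? zero    u w = u ≟ᶠ w
  within? (suc m) u w = u ≟ᶠ w ⊎-dec any? λ v → (R F u v ≟ᵇ true) ×-dec within? m v w

  Within-refl : ∀ m {w} → Within F m w w
  Within-refl zero    = refl
  Within-refl (suc m) = inj₁ refl

  Within-suc : ∀ m {u w} → Within F m u w → Within F (suc m) u w
  Within-suc zero    u≡w                       = inj₁ u≡w
  Within-suc (suc m) (inj₁ u≡w)                = inj₁ u≡w
  Within-suc (suc m) (inj₂ (v , r , within))   = inj₂ (v , r , Within-suc m within)

  Within-snoc : ∀ m {u w v} → Within F m u w → R F w v ≡ true → Within F (suc m) u v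
  Within-snoc zero    refl                       r = inj₂ (_ , r , refl)
  Within-snoc (suc m) (inj₁ refl)                r = inj₂ (_ , r , Within-refl (suc m))
  Within-snoc (suc m) (inj₂ (x , r′ , within))   r = inj₂ (x , r′ , Within-snoc m within r)

  -- The worlds not reached within m steps form a descending chain; once it is stable, the worlds
  -- reached are closed under R, hence, F being rooted, they are all worlds.
  reachable-within : ∀ w → ∃[ m ] m ≤ suc (size F) × Within F m zero w
  reachable-within w
    with descending-chain-stabilises (worlds F) (∈-worlds {F = F}) {P = λ m w → ¬ Within F m zero w}
           (λ m w → ¬? (within? m zero w)) (λ m ¬within → ¬within ∘ Within-suc m)
  ... | m , m≤ , stable = m , subst (m ≤_) (length-worlds F) m≤ , reach (rooted F w) (Within-refl m)
    where
    reach : ∀ {u v} → Star (λ a b → R F a b ≡ true) u v → Within F m zero u → Within F m zero v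
    reach ε          within = within
    reach (r ◅ path) within = reach path
      (decidable-stable (within? m zero _) λ ¬within → stable ¬within (Within-snoc m within r))

sat? : (F : Frame) (V : Valuation F) (w : World F) (φ : Fm) → Dec (sat F V w φ)
sat? F V w (var p)    = V w p ≟ᵇ true
sat? F V w top        = yes tt
sat? F V w (neg φ)    = ¬? (sat? F V w φ)
sat? F V w (conj φ ψ) = sat? F V w φ ×-dec sat? F V w ψ
sat? F V w (box φ)    = all? λ v → (R F w v ≟ᵇ true) →-dec sat? F V v φ

module Semantics (F : Frame) (V : Valuation F) where

  module _ {w : World F} {f : A → Fm} where

    ⋀-intro : ∀ xs → (∀ {x} → x ∈ xs → sat F V w (f x)) → sat F V w (⋀ xs f)
    ⋀-intro []       _   = tt
    ⋀-intro (x ∷ xs) all = all (here refl) , ⋀-intro xs (all ∘ there)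

    ⋀-elim : ∀ {x} xs → sat F V w (⋀ xs f) → x ∈ xs → sat F V w (f x)
    ⋀-elim (x ∷ xs) (fx , _)    (here refl) = fx
    ⋀-elim (x ∷ xs) (_  , rest) (there x∈)  = ⋀-elim xs rest x∈

  module _ {w : World F} where

    ⋁-intro : {f : A → Fm} → ∀ {x} xs → x ∈ xs → sat F V w (f x) → sat F V w (⋁ xs f)
    ⋁-intro {f = f} xs x∈ fx all¬ = ⋀-elim {f = neg ∘ f} xs all¬ x∈ fx

    ⋁-elim : {f : A → Fm} → ∀ xs → sat F V w (⋁ xs f) → ∃[ x ] x ∈ xs × sat F V w (f x)
    ⋁-elim {f = f} xs ¬all¬ = find (decidable-stable (Any.any? (λ x → sat? F V w (f x)) xs)
      λ none → ¬all¬ (⋀-intro {f = neg ∘ f} xs λ x∈ fx → none (lose x∈ fx)))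

    ⇒-intro : (sat F V w φ → sat F V w ψ) → sat F V w (φ ⇒ ψ)
    ⇒-intro f (φ-holds , ¬ψ) = ¬ψ (f φ-holds)

    ⇒-elim : sat F V w (φ ⇒ ψ) → sat F V w φ → sat F V w ψ
    ⇒-elim {ψ = ψ} φ⇒ψ φ-holds = decidable-stable (sat? F V w ψ) λ ¬ψ → φ⇒ψ (φ-holds , ¬ψ)

    ◇-intro : ∀ {v} → R F w v ≡ true → sat F V v φ → sat F V w (◇ φ)
    ◇-intro wRv φ-holds □¬φ = □¬φ _ wRv φ-holds

    ◇-elim : sat F V w (◇ φ) → ∃[ v ] R F w v ≡ true × sat F V v φ
    ◇-elim {φ = φ} ◇φ =
      decidable-stable (any? λ v → (R F w v ≟ᵇ true) ×-dec sat? F V v φ)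
        λ none → ◇φ λ v wRv φ-holds → none (v , wRv , φ-holds)

  □≤-intro : ∀ d {w} → (∀ v → sat F V v θ) → sat F V w (□≤ d θ)
  □≤-intro zero    everywhere = everywhere _
  □≤-intro (suc d) everywhere = everywhere _ , λ v _ → □≤-intro d everywhere

  □≤-elim : ∀ m d {u w} → m ≤ d → sat F V u (□≤ d θ) → Within F m u w → sat F V w θ
  □≤-elim zero    zero    _         θu       refl = θu
  □≤-elim zero    (suc d) _         (θu , _) refl = θu
  □≤-elim (suc m) (suc d) _         (θu , _) (inj₁ refl) = θu
  □≤-elim (suc m) (suc d) (s≤s m≤d) (_ , □θ) (inj₂ (v , r , within)) = □≤-elim m d m≤d (□θ v r) within

  □≤-everywhere : ∀ {d} → size F < d → sat F V zero (□≤ d θ) → ∀ w → sat F V w θ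
  □≤-everywhere size<d □θ w =
    let m , m≤ , within = reachable-within w in □≤-elim m _ (≤-trans m≤ size<d) □θ within

  sat-atomicType : ∀ {a w} → sat F V w (atomicType σ a) ⇔ (∀ {p} → p ∈ σ → V w p ≡ a p)
  sat-atomicType {σ = σ} = mk⇔
    (λ τ {p} p∈ → to (sat-literal _) (⋀-elim σ τ p∈))
    (λ agree → ⋀-intro σ λ p∈ → from (sat-literal _) (agree p∈))
    where
    sat-literal : ∀ {w} b → sat F V w (literal b p) ⇔ (V w p ≡ b)
    sat-literal true  = mk⇔ id id
    sat-literal false = mk⇔ ¬-not not-¬

-- Bisimulations and p-morphisms

module _ {F₁ F₂ : Frame} {V₁ : Valuation F₁} {V₂ : Valuation F₂} {Z : World F₁ → World F₂ → Set}
         (bisim : IsBisim σ F₁ V₁ F₂ V₂ Z) where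

  open IsBisim bisim

  sat-bisim-invariant : ∀ φ → (∀ {p} → Occurs p φ → p ∈ σ) →
                        ∀ {w₁ w₂} → Z w₁ w₂ → sat F₁ V₁ w₁ φ ⇔ sat F₂ V₂ w₂ φ
  sat-bisim-invariant (var p) φ⊆σ z =
    mk⇔ (trans (sym (atoms z p (φ⊆σ here)))) (trans (atoms z p (φ⊆σ here)))
  sat-bisim-invariant top _ _ = mk⇔ id id
  sat-bisim-invariant (neg φ) φ⊆σ z = ¬-cong-⇔ (sat-bisim-invariant φ (λ o → φ⊆σ (neg′ o)) z)
  sat-bisim-invariant (conj φ ψ) φ⊆σ z =
    sat-bisim-invariant φ (λ o → φ⊆σ (conjˡ o)) z ×-⇔ sat-bisim-invariant ψ (λ o → φ⊆σ (conjʳ o)) z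
  sat-bisim-invariant (box φ) φ⊆σ z = mk⇔
    (λ □φ v₂ r → let v₁ , r₁ , z′ = back z r in to (invariant z′) (□φ v₁ r₁))
    (λ □φ v₁ r → let v₂ , r₂ , z′ = forth z r in from (invariant z′) (□φ v₂ r₂))
    where
    invariant : ∀ {v₁ v₂} → Z v₁ v₂ → sat F₁ V₁ v₁ φ ⇔ sat F₂ V₂ v₂ φ
    invariant = sat-bisim-invariant φ (λ o → φ⊆σ (box′ o))

  isBisim-revalue : {V₁′ : Valuation F₁} {V₂′ : Valuation F₂} →
                    (∀ w {p} → p ∈ σ → V₁′ w p ≡ V₁ w p) → (∀ w {p} → p ∈ σ → V₂′ w p ≡ V₂ w p) →
                    IsBisim σ F₁ V₁′ F₂ V₂′ Z
  isBisim-revalue agree₁ agree₂ = record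
    { atoms = λ {w₁} {w₂} z p p∈ → trans (agree₁ w₁ p∈) (trans (atoms z p p∈) (sym (agree₂ w₂ p∈)))
    ; forth = forth
    ; back  = back
    }

≡-isBisim : {V₁ V₂ : Valuation F} → (∀ w {p} → p ∈ σ → V₁ w p ≡ V₂ w p) → IsBisim σ F V₁ F V₂ _≡_
≡-isBisim agree = record
  { atoms = λ { {w} refl p p∈ → agree w p∈ }
  ; forth = λ { refl r → _ , r , refl }
  ; back  = λ { refl r → _ , r , refl }
  }

sat-agree : {V₁ V₂ : Valuation F} {w : World F} → (∀ w {p} → p ∈ σ → V₁ w p ≡ V₂ w p) →
            (∀ {p} → Occurs p φ → p ∈ σ) → sat F V₁ w φ ⇔ sat F V₂ w φ
sat-agree {φ = φ} agree φ⊆σ = sat-bisim-invariant (≡-isBisim agree) φ φ⊆σ refl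

record IsPMorphism (G F : Frame) (g : World G → World F) : Set where
  field
    forth : ∀ {x y} → R G x y ≡ true → R F (g x) (g y) ≡ true
    back  : ∀ {x v} → R F (g x) v ≡ true → ∃[ y ] R G x y ≡ true × g y ≡ v

module _ {g : World G → World F} (pmorphism : IsPMorphism G F g) where

  open IsPMorphism pmorphism

  graph-isBisim : {W : Valuation G} {V : Valuation F} →
                  (∀ x {p} → p ∈ σ → W x p ≡ V (g x) p) → IsBisim σ G W F V (λ x v → g x ≡ v)
  graph-isBisim agree = record
    { atoms = λ { {x} refl p p∈ → agree x p∈ }
    ; forth = λ { refl xRy → _ , forth xRy , refl }
    ; back  = λ { refl r → back r }
    }

  root-preserving⇒Log₁-⊆ : g zero ≡ zero → ∀ φ → Log₁ G φ → Log₁ F φ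
  root-preserving⇒Log₁-⊆ g₀ φ valid V =
    to (sat-bisim-invariant (graph-isBisim (λ _ _ → refl)) φ ∈-sig⁺ g₀) (valid (V ∘ g))

  root-preserving⇒surjective : g zero ≡ zero → StrictlySurjective _≡_ g
  root-preserving⇒surjective g₀ v = image-closed (rooted F v) (zero , g₀)
    where
    image-closed : ∀ {u v} → Star (λ a b → R F a b ≡ true) u v → ∃[ x ] g x ≡ u → ∃[ x ] g x ≡ v
    image-closed ε             hit = hit
    image-closed (uRu′ ◅ u′⋆v) (x , refl) =
      let y , _ , gy≡u′ = back uRu′ in image-closed u′⋆v (y , gy≡u′)

-- Isomorphisms of σ-reducts

-- A value y outside the image could be punched out, making f an injection Fin (suc n) → Fin n.
injective⇒surjective : {f : Fin n → Fin n} → Injective _≡_ _≡_ f → StrictlySurjective _≡_ f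
injective⇒surjective {suc n} {f} f-injective y with any? (λ x → f x ≟ᶠ y)
... | yes hit  = hit
... | no  miss = contradiction (injective⇒≤ punched-injective) 1+n≰n
  where
  punched : Fin (suc n) → Fin n
  punched x = punchOut {i = y} {j = f x} λ y≡fx → miss (x , sym y≡fx)
  punched-injective : Injective _≡_ _≡_ punched
  punched-injective eq = f-injective (punchOut-injective {i = y} _ _ eq)

module _ {f : Fin n → Fin n} (f-surjective : StrictlySurjective _≡_ f) where

  private
    section : Fin n → Fin n
    section = proj₁ ∘ f-surjective

    section-inverse : ∀ y → f (section y) ≡ y
    section-inverse = proj₂ ∘ f-surjective

    section-injective : Injective _≡_ _≡_ section
    section-injective {x} {y} eq =
      trans (sym (section-inverse x)) (trans (cong f eq) (section-inverse y))

  surjective⇒injective : Injective _≡_ _≡_ f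
  surjective⇒injective {a} {b} fa≡fb
    with injective⇒surjective section-injective a | injective⇒surjective section-injective b
  ... | x , refl | y , refl = cong section (begin
    x             ≡⟨ section-inverse x ⟨
    f (section x) ≡⟨ fa≡fb ⟩
    f (section y) ≡⟨ section-inverse y ⟩
    y             ∎)
    where open ≡-Reasoning

true⇔true⇒≡ : {a b : Bool} → (a ≡ true → b ≡ true) → (b ≡ true → a ≡ true) → a ≡ b
true⇔true⇒≡ {true}  a⇒b _ = sym (a⇒b refl)
true⇔true⇒≡ {false} {true}  _ b⇒a = b⇒a refl
true⇔true⇒≡ {false} {false} _ _   = refl

record ReductPMorphism (σ : List ℕ) (G : Frame) (W : Valuation G) (F : Frame) (V : Valuation F) :
                       Set where
  field
    fun       : World G → World F
    pmorphism : IsPMorphism G F fun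
    root      : fun zero ≡ zero
    atoms     : ∀ x {p} → p ∈ σ → W x p ≡ V (fun x) p

module _ {W : Valuation G} {V : Valuation F} (g : ReductPMorphism σ G W F V) where

  open ReductPMorphism g

  ReductPMorphism⇒Log₁-⊆ : ∀ φ → Log₁ G φ → Log₁ F φ
  ReductPMorphism⇒Log₁-⊆ = root-preserving⇒Log₁-⊆ pmorphism root

endomorphism⇒ReductIso : {W V : Valuation F} →
                         ReductPMorphism σ F W F V → ReductIso σ F W zero F V zero
endomorphism⇒ReductIso {F = F} g = record
  { f     = mk⤖ (fun-injective , strictlySurjective⇒surjective fun-surjective)
  ; point = root
  ; rel   = λ u v → true⇔true⇒≡ forth (reflects u v)
  ; atoms = λ w p → atoms w
  }
  where
  open ReductPMorphism g
  open IsPMorphism pmorphism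
  fun-surjective : StrictlySurjective _≡_ fun
  fun-surjective = root-preserving⇒surjective pmorphism root
  fun-injective : Injective _≡_ _≡_ fun
  fun-injective = surjective⇒injective fun-surjective
  reflects : ∀ u v → R F (fun u) (fun v) ≡ true → R F u v ≡ true
  reflects u v r =
    let y , uRy , fy≡fv = back r in subst (λ z → R F u z ≡ true) (fun-injective fy≡fv) uRy

module _ {F₁ F₂ : Frame} {V₁ : Valuation F₁} {V₂ : Valuation F₂} {w₁ : World F₁} {w₂ : World F₂}
         (iso : ReductIso σ F₁ V₁ w₁ F₂ V₂ w₂) where

  open ReductIso iso renaming (f to bijection)
  open Bijection bijection using (injective; surjective; strictlySurjective) renaming (to to h)

  private
    h⁻¹ : World F₂ → World F₁
    h⁻¹ = Bijection.to (⤖-sym bijection)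
    h∘h⁻¹ : ∀ y → h (h⁻¹ y) ≡ y
    h∘h⁻¹ y = proj₂ (surjective y) refl

  ReductIso-sym : ReductIso σ F₂ V₂ w₂ F₁ V₁ w₁
  ReductIso-sym = record
    { f     = ⤖-sym bijection
    ; point = injective (trans (h∘h⁻¹ w₂) (sym point))
    ; rel   = λ u v → sym (trans (rel (h⁻¹ u) (h⁻¹ v)) (cong₂ (R F₂) (h∘h⁻¹ u) (h∘h⁻¹ v)))
    ; atoms = λ w p p∈ → sym (trans (atoms (h⁻¹ w) p p∈) (cong (λ x → V₂ x p) (h∘h⁻¹ w)))
    }

  ReductIso⇒IsPMorphism : IsPMorphism F₁ F₂ h
  ReductIso⇒IsPMorphism = record
    { forth = λ {x} {y} xRy → trans (sym (rel x y)) xRy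
    ; back  = λ {x} {v} r → let y , y↦v = strictlySurjective v in
                y , trans (rel x y) (subst (λ z → R F₂ (h x) z ≡ true) (sym y↦v) r) , y↦v
    }

ReductIso-trans : {F₁ F₂ F₃ : Frame} {V₁ : Valuation F₁} {V₂ : Valuation F₂} {V₃ : Valuation F₃}
                  {w₁ : World F₁} {w₂ : World F₂} {w₃ : World F₃} →
                  ReductIso σ F₁ V₁ w₁ F₂ V₂ w₂ → ReductIso σ F₂ V₂ w₂ F₃ V₃ w₃ →
                  ReductIso σ F₁ V₁ w₁ F₃ V₃ w₃
ReductIso-trans iso₁ iso₂ = record
  { f     = I₂.f ⤖-∘ I₁.f
  ; point = trans (cong (Bijection.to I₂.f) I₁.point) I₂.point
  ; rel   = λ u v → trans (I₁.rel u v) (I₂.rel _ _)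
  ; atoms = λ w p p∈ → trans (I₁.atoms w p p∈) (I₂.atoms _ p p∈)
  }
  where
  module I₁ = ReductIso iso₁
  module I₂ = ReductIso iso₂

module _ {B : Set} (_≟_ : DecidableEquality A) (default : B) where

  update : A → B → (A → B) → A → B
  update a b f a′ with a′ ≟ a
  ... | yes _ = b
  ... | no  _ = f a′

  functions : List A → List B → List (A → B)
  functions []       bs = const default ∷ []
  functions (a ∷ as) bs = cartesianProductWith (update a) bs (functions as bs)

  functions-complete : ∀ {ℓ} (_≈_ : B → B → Set ℓ) {bs} → (∀ b → ∃[ b′ ] b′ ∈ bs × b′ ≈ b) →
                       ∀ as (f : A → B) → ∃[ g ] g ∈ functions as bs × (∀ {a} → a ∈ as → g a ≈ f a)
  functions-complete _≈_ cover []       f = const default , here refl , λ ()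
  functions-complete _≈_ cover (a ∷ as) f
    with cover (f a) | functions-complete _≈_ cover as f
  ... | b , b∈ , b≈fa | g , g∈ , g≈f = update a b g , ∈-cartesianProductWith⁺ (update a) b∈ g∈ , agrees
    where
    agrees : ∀ {a′} → a′ ∈ a ∷ as → update a b g a′ ≈ f a′
    agrees {a′} a′∈ with a′ ≟ a
    agrees _             | yes refl = b≈fa
    agrees (here refl)   | no  a′≢a = contradiction refl a′≢a
    agrees (there a′∈as) | no  _    = g≈f a′∈as

valuations : (F : Frame) → List ℕ → List (Valuation F)
valuations F as = functions _≟ᶠ_ (const false) (worlds F) (functions _≟ⁿ_ false as (true ∷ false ∷ []))

valuations-complete : ∀ as (W : Valuation F) →
                      ∃[ V ] V ∈ valuations F as × (∀ w {p} → p ∈ as → V w p ≡ W w p)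
valuations-complete {F = F} as W =
  let V , V∈ , V≈W = functions-complete _≟ᶠ_ (const false) (λ f g → ∀ {p} → p ∈ as → f p ≡ g p)
                       (functions-complete _≟ⁿ_ false _≡_ bits as) (worlds F) W
  in V , V∈ , λ w → V≈W (∈-worlds {F = F} w)
  where
  bits : ∀ b → ∃[ b′ ] b′ ∈ true ∷ false ∷ [] × b′ ≡ b
  bits true  = true  , here refl , refl
  bits false = false , there (here refl) , refl

Satisfiable : (Fin n → Frame) → Fm → Set
Satisfiable Fs φ = ∃[ k ] Σ (Valuation (Fs k)) λ V → sat (Fs k) V zero φ

satisfiable? : (Fs : Fin n → Frame) (φ : Fm) → Dec (Satisfiable Fs φ)
satisfiable? Fs φ =
  map′ found cover (any? λ k → Any.any? (λ V → sat? (Fs k) V zero φ) (valuations (Fs k) (sig φ)))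
  where
  found : ∃[ k ] Any (λ V → sat (Fs k) V zero φ) (valuations (Fs k) (sig φ)) → Satisfiable Fs φ
  found (k , hit) = let V , _ , φ-holds = find hit in k , V , φ-holds
  cover : Satisfiable Fs φ → ∃[ k ] Any (λ V → sat (Fs k) V zero φ) (valuations (Fs k) (sig φ))
  cover (k , W , φ-holds) =
    let V , V∈ , V≈W = valuations-complete {F = Fs k} (sig φ) W
    in k , lose V∈ (from (sat-agree V≈W ∈-sig⁺) φ-holds)

-- (1) ⇒ (2): diagrams

module _ (σ : List ℕ) (F : Frame) (V : Valuation F) (code : World F → ℕ) where

  withCodes : Valuation F
  withCodes x p with p ∈? σ
  ... | yes _ = V x p
  ... | no  _ with p ≟ⁿ code x
  ...   | yes _ = true
  ...   | no  _ = false

  withCodes-agrees : ∀ x {p} → p ∈ σ → withCodes x p ≡ V x p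
  withCodes-agrees x {p} p∈ with p ∈? σ
  ... | yes _  = refl
  ... | no  p∉ = contradiction p∈ p∉

  module _ (code-fresh : ∀ w → code w ∉ σ) (code-injective : Injective _≡_ _≡_ code) where

    withCodes-coded : ∀ x → withCodes x (code x) ≡ true
    withCodes-coded x with code x ∈? σ
    ... | yes c∈ = contradiction c∈ (code-fresh x)
    ... | no  _ with code x ≟ⁿ code x
    ...   | yes _ = refl
    ...   | no  c≢c = contradiction refl c≢c

    withCodes-uncoded : ∀ {x w} → withCodes x (code w) ≡ true → w ≡ x
    withCodes-uncoded {x} {w} coded with code w ∈? σ
    ... | yes c∈ = contradiction c∈ (code-fresh w)
    ... | no  _ with code w ≟ⁿ code x
    ...   | yes cw≡cx = code-injective cw≡cx
    ...   | no  _     = contradiction coded λ ()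

module Diagram (σ : List ℕ) (F : Frame) (V : Valuation F) (code : World F → ℕ) (d : ℕ) where

  others : World F → List (World F)
  others w = filter (λ v → ¬? (v ≟ᶠ w)) (worlds F)

  ∈-others⁺ : ∀ {v w} → v ≢ w → v ∈ others w
  ∈-others⁺ {v} {w} = ∈-filter⁺ (λ v → ¬? (v ≟ᶠ w)) (∈-worlds {F = F} v)

  ∈-others⁻ : ∀ {v w} → v ∈ others w → v ≢ w
  ∈-others⁻ {w = w} = proj₂ ∘ ∈-filter⁻ (λ v → ¬? (v ≟ᶠ w)) {xs = worlds F}

  node : World F → Fm
  node w = conj (var (code w))
          (conj (atomicType σ (V w))
          (conj (⋀ (others w) (neg ∘ var ∘ code))
          (conj (⋀ (successors F w) (◇ ∘ var ∘ code))
                (box (⋁ (successors F w) (var ∘ code))))))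

  Δ : Fm
  Δ = conj (var (code zero)) (□≤ d (⋁ (worlds F) node))

  node-occurs : ∀ w → Occurs p (node w) → p ∈ σ ⊎ ∃[ v ] p ≡ code v
  node-occurs w (conjˡ here)             = inj₂ (w , refl)
  node-occurs w (conjʳ (conjˡ o))        = inj₁ (atomicType-occurs o)
  node-occurs w (conjʳ (conjʳ (conjˡ o))) with ⋀-occurs (others w) o
  ... | v , _ , neg′ here = inj₂ (v , refl)
  node-occurs w (conjʳ (conjʳ (conjʳ (conjˡ o)))) with ⋀-occurs (successors F w) o
  ... | v , _ , neg′ (box′ (neg′ here)) = inj₂ (v , refl)
  node-occurs w (conjʳ (conjʳ (conjʳ (conjʳ (box′ o))))) with ⋁-occurs (successors F w) o
  ... | v , _ , here = inj₂ (v , refl)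

  Δ-occurs : Occurs p Δ → p ∈ σ ⊎ ∃[ w ] p ≡ code w
  Δ-occurs (conjˡ here) = inj₂ (zero , refl)
  Δ-occurs (conjʳ o) with ⋁-occurs (worlds F) (□≤-occurs d o)
  ... | w , _ , o′ = node-occurs w o′

  module _ (code-fresh : ∀ w → code w ∉ σ) (code-injective : Injective _≡_ _≡_ code) where

    private
      W : Valuation F
      W = withCodes σ F V code

      coded : ∀ x → W x (code x) ≡ true
      coded = withCodes-coded σ F V code code-fresh code-injective

    open Semantics F W

    node-holds : ∀ x → sat F W x (node x)
    node-holds x = coded x
                 , from sat-atomicType (withCodes-agrees σ F V code x)
                 , ⋀-intro (others x) (λ v∈ coded-v →
                     ∈-others⁻ v∈ (withCodes-uncoded σ F V code code-fresh code-injective coded-v))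
                 , ⋀-intro (successors F x) (λ v∈ → ◇-intro (∈-successors⁻ v∈) (coded _))
                 , λ y xRy → ⋁-intro (successors F x) (∈-successors⁺ xRy) (coded y)

    Δ-holds : sat F (withCodes σ F V code) zero Δ
    Δ-holds = coded zero , □≤-intro d λ x → ⋁-intro (worlds F) (∈-worlds {F = F} x) (node-holds x)

  module Extraction {G : Frame} {W : Valuation G} (size<d : size G < d) (Δ-holds : sat G W zero Δ) where

    open Semantics G W

    private
      nodes : ∀ x → ∃[ w ] w ∈ worlds F × sat G W x (node w)
      nodes x = ⋁-elim (worlds F) (□≤-everywhere size<d (proj₂ Δ-holds) x)

      g : World G → World F
      g x = proj₁ (nodes x)

      g-node : ∀ x → sat G W x (node (g x))
      g-node x = proj₂ (proj₂ (nodes x))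

      g-unique : ∀ {x v} → W x (code v) ≡ true → v ≡ g x
      g-unique {x} {v} coded-v with g-node x
      ... | _ , _ , others-uncoded , _ = decidable-stable (v ≟ᶠ g x) λ v≢gx →
        ⋀-elim (others (g x)) others-uncoded (∈-others⁺ v≢gx) coded-v

      g-forth : ∀ {x y} → R G x y ≡ true → R F (g x) (g y) ≡ true
      g-forth {x} {y} xRy with g-node x
      ... | _ , _ , _ , _ , □successor with ⋁-elim (successors F (g x)) (□successor y xRy)
      ...   | v , v∈ , coded-v = subst (λ u → R F (g x) u ≡ true) (g-unique coded-v) (∈-successors⁻ v∈)

      g-back : ∀ {x v} → R F (g x) v ≡ true → ∃[ y ] R G x y ≡ true × g y ≡ v
      g-back {x} {v} r with g-node x
      ... | _ , _ , _ , ◇successors , _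
        with ◇-elim (⋀-elim (successors F (g x)) ◇successors (∈-successors⁺ r))
      ...   | y , xRy , coded-v = y , xRy , sym (g-unique coded-v)

    extract : ReductPMorphism σ G W F V
    extract = record
      { fun       = g
      ; pmorphism = record { forth = g-forth ; back = g-back }
      ; root      = sym (g-unique (proj₁ Δ-holds))
      ; atoms     = λ x → to sat-atomicType (proj₁ (proj₂ (g-node x)))
      }

sizeBound : (Fin n → Frame) → ℕ
sizeBound {n} Fs = max 0 (map (size ∘ Fs) (allFin n))

size≤sizeBound : (Fs : Fin n → Frame) (k : Fin n) → size (Fs k) ≤ sizeBound Fs
size≤sizeBound Fs k = All.lookup (xs≤max 0 _) (∈-map⁺ (size ∘ Fs) (∈-allFin k))

reduced⇒≡ : {Fs : Fin n → Frame} → Reduced Fs → ∀ {k i} → (∀ φ → Log₁ (Fs k) φ → Log₁ (Fs i) φ) → k ≡ i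
reduced⇒≡ reduced {k} {i} Log⊆ = decidable-stable (k ≟ᶠ i) λ k≢i → reduced k i k≢i Log⊆

common-cover⇒ReductIso : {Fs : Fin n → Frame} → Reduced Fs → ∀ {k i j} {W : Valuation (Fs k)}
                         {V : Valuation (Fs i)} {U : Valuation (Fs j)} →
                         ReductPMorphism σ (Fs k) W (Fs i) V → ReductPMorphism σ (Fs k) W (Fs j) U →
                         ReductIso σ (Fs i) V zero (Fs j) U zero
common-cover⇒ReductIso reduced g h
  with reduced⇒≡ reduced (ReductPMorphism⇒Log₁-⊆ g) | reduced⇒≡ reduced (ReductPMorphism⇒Log₁-⊆ h)
... | refl | refl =
  ReductIso-trans (ReductIso-sym (endomorphism⇒ReductIso g)) (endomorphism⇒ReductIso h)

module Separation {n} (Fs : Fin n → Frame) (σ : List ℕ) {i j : Fin n}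
                  (V : Valuation (Fs i)) (U : Valuation (Fs j)) where

  join-worlds : World (Fs i) ⊎ World (Fs j) → Fin (suc (size (Fs i)) + suc (size (Fs j)))
  join-worlds = join (suc (size (Fs i))) (suc (size (Fs j)))

  code : World (Fs i) ⊎ World (Fs j) → ℕ
  code w = suc (max 0 σ) + toℕ (join-worlds w)

  code-injective : Injective _≡_ _≡_ code
  code-injective {w} {v} cw≡cv = begin
    w                         ≡⟨ splitAt-join _ _ w ⟨
    splitAt _ (join-worlds w) ≡⟨ cong (splitAt _) (toℕ-injective {i = join-worlds w} {j = join-worlds v}
                                                  (+-cancelˡ-≡ (suc (max 0 σ)) _ _ cw≡cv)) ⟩
    splitAt _ (join-worlds v) ≡⟨ splitAt-join _ _ v ⟩
    v                         ∎
    where open ≡-Reasoning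

  code-fresh : ∀ w → code w ∉ σ
  code-fresh w c∈ = 1+n≰n (≤-trans (m≤m+n _ _) (All.lookup (xs≤max 0 σ) c∈))

  d : ℕ
  d = suc (sizeBound Fs)

  module M = Diagram σ (Fs i) V (code ∘ inj₁) d
  module N = Diagram σ (Fs j) U (code ∘ inj₂) d

  Δ-shared-atoms : ∀ {p} → Occurs p M.Δ × Occurs p (neg N.Δ) → p ∈ σ
  Δ-shared-atoms (oM , neg′ oN) with M.Δ-occurs oM | N.Δ-occurs oN
  ... | inj₁ p∈         | _                = p∈
  ... | inj₂ _          | inj₁ p∈          = p∈
  ... | inj₂ (w , refl) | inj₂ (v , cw≡cv) with code-injective {inj₁ w} {inj₂ v} cw≡cv
  ...   | ()

  jointly-satisfiable⇒ReductIso : Reduced Fs → Satisfiable Fs (conj M.Δ N.Δ) →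
                                  ReductIso σ (Fs i) V zero (Fs j) U zero
  jointly-satisfiable⇒ReductIso reduced (k , W , ΔM-holds , ΔN-holds) =
    common-cover⇒ReductIso reduced (M.Extraction.extract size<d ΔM-holds)
                                   (N.Extraction.extract size<d ΔN-holds)
    where
    size<d : size (Fs k) < d
    size<d = s≤s (size≤sizeBound Fs k)

  -- Were Δ_M ∧ Δ_N unsatisfiable, the σ-interpolant of Δ_M → ¬Δ_N would separate the σ-bisimilar
  -- roots of the models of Δ_M and Δ_N obtained by adding the names.
  bisimilar⇒jointly-satisfiable : CIP (Log Fs) → Bisimilar σ (Fs i) V zero (Fs j) U zero →
                                  Satisfiable Fs (conj M.Δ N.Δ)
  bisimilar⇒jointly-satisfiable cip (Z , bisim , z₀) =
    decidable-stable (satisfiable? Fs (conj M.Δ N.Δ)) λ unsatisfiable →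
      let χ , ΔM⇒χ , χ⇒¬ΔN , χ-shared = cip M.Δ (neg N.Δ) λ k W (ΔM , ¬¬ΔN) →
                                           ¬¬ΔN λ ΔN → unsatisfiable (k , W , ΔM , ΔN)
          χ-in-M = Semantics.⇒-elim (Fs i) V′ {φ = M.Δ} {ψ = χ} (ΔM⇒χ i V′) ΔM-holds
          χ-in-N = to (sat-bisim-invariant bisim′ χ (λ o → Δ-shared-atoms (χ-shared _ o)) z₀) χ-in-M
      in Semantics.⇒-elim (Fs j) U′ {φ = χ} {ψ = neg N.Δ} (χ⇒¬ΔN j U′) χ-in-N ΔN-holds
    where
    V′ : Valuation (Fs i)
    V′ = withCodes σ (Fs i) V (code ∘ inj₁)
    U′ : Valuation (Fs j)
    U′ = withCodes σ (Fs j) U (code ∘ inj₂)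
    ΔM-holds : sat (Fs i) V′ zero M.Δ
    ΔM-holds = M.Δ-holds (code-fresh ∘ inj₁) (inj₁-injective ∘ code-injective)
    ΔN-holds : sat (Fs j) U′ zero N.Δ
    ΔN-holds = N.Δ-holds (code-fresh ∘ inj₂) (inj₂-injective ∘ code-injective)
    bisim′ : IsBisim σ (Fs i) V′ (Fs j) U′ Z
    bisim′ = isBisim-revalue bisim (withCodes-agrees σ (Fs i) V _) (withCodes-agrees σ (Fs j) U _)

cip⇒condition2 : {Fs : Fin n → Frame} → Reduced Fs → CIP (Log Fs) → Condition2 Fs
cip⇒condition2 {Fs = Fs} reduced cip σ i j V U bisimilar =
  jointly-satisfiable⇒ReductIso reduced (bisimilar⇒jointly-satisfiable cip bisimilar)
  where open Separation Fs σ V U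

-- (2) ⇒ (1): characteristic formulas

module Approximation (σ : List ℕ) (F₁ : Frame) (V₁ : Valuation F₁) (F₂ : Frame) (V₂ : Valuation F₂) where

  Agree : World F₁ → World F₂ → Set
  Agree w x = ∀ {p} → p ∈ σ → V₁ w p ≡ V₂ x p

  _∼[_]_ : World F₁ → ℕ → World F₂ → Set
  w ∼[ zero  ] x = Agree w x
  w ∼[ suc m ] x = Agree w x
                 × (∀ v → R F₁ w v ≡ true → ∃[ y ] R F₂ x y ≡ true × v ∼[ m ] y)
                 × (∀ y → R F₂ x y ≡ true → ∃[ v ] R F₁ w v ≡ true × v ∼[ m ] y)

  agree? : ∀ w x → Dec (Agree w x)
  agree? w x = map′ All.lookup All.tabulate (All.all? (λ p → V₁ w p ≟ᵇ V₂ x p) σ)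

  ∼? : ∀ m w x → Dec (w ∼[ m ] x)
  ∼? zero    w x = agree? w x
  ∼? (suc m) w x = agree? w x
    ×-dec all? (λ v → (R F₁ w v ≟ᵇ true) →-dec any? λ y → (R F₂ x y ≟ᵇ true) ×-dec ∼? m v y)
    ×-dec all? (λ y → (R F₂ x y ≟ᵇ true) →-dec any? λ v → (R F₁ w v ≟ᵇ true) ×-dec ∼? m v y)

  ∼⇒Agree : ∀ m {w x} → w ∼[ m ] x → Agree w x
  ∼⇒Agree zero    agree       = agree
  ∼⇒Agree (suc m) (agree , _) = agree

  ∼-antitone : ∀ {m m′ w x} → m ≤ m′ → w ∼[ m′ ] x → w ∼[ m ] x
  ∼-antitone {zero} {m′} _ w∼x = ∼⇒Agree m′ w∼x
  ∼-antitone {suc m} {suc m′} (s≤s m≤m′) (agree , forth , back) =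
    agree , (λ v r → map₂ (map₂ (∼-antitone m≤m′)) (forth v r))
          , (λ y r → map₂ (map₂ (∼-antitone m≤m′)) (back y r))

  stable⇒isBisim : ∀ {m} → (∀ {w x} → w ∼[ m ] x → w ∼[ suc m ] x) → IsBisim σ F₁ V₁ F₂ V₂ _∼[ m ]_
  stable⇒isBisim {m} stable = record
    { atoms = λ w∼x p → ∼⇒Agree m w∼x
    ; forth = λ w∼x r → proj₁ (proj₂ (stable w∼x)) _ r
    ; back  = λ w∼x r → proj₂ (proj₂ (stable w∼x)) _ r
    }

  ∼-stabilises : ∃[ m ] m ≤ suc (size F₁) * suc (size F₂) × (∀ {w x} → w ∼[ m ] x → w ∼[ suc m ] x)
  ∼-stabilises
    with descending-chain-stabilises (cartesianProduct (worlds F₁) (worlds F₂))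
           (λ (w , x) → ∈-cartesianProduct⁺ (∈-worlds {F = F₁} w) (∈-worlds {F = F₂} x))
           {P = λ m (w , x) → w ∼[ m ] x} (λ m (w , x) → ∼? m w x) (λ m → ∼-antitone (n≤1+n m))
  ... | m , m≤ , stable = m , subst (m ≤_) pairs m≤ , λ {w} {x} → stable {w , x}
    where
    pairs : length (cartesianProduct (worlds F₁) (worlds F₂)) ≡ suc (size F₁) * suc (size F₂)
    pairs = trans (length-cartesianProduct (worlds F₁) (worlds F₂))
                  (cong₂ _*_ (length-worlds F₁) (length-worlds F₂))

  ∼-deep⇒bisimilar : ∀ {D w x} → suc (size F₁) * suc (size F₂) ≤ D → w ∼[ D ] x →
                     Bisimilar σ F₁ V₁ w F₂ V₂ x
  ∼-deep⇒bisimilar bound w∼x =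
    let m , m≤ , stable = ∼-stabilises
    in _∼[ m ]_ , stable⇒isBisim stable , ∼-antitone (≤-trans m≤ bound) w∼x

module Characteristic (σ : List ℕ) (F : Frame) (V : Valuation F) where

  char : ℕ → World F → Fm
  char zero    w = atomicType σ (V w)
  char (suc m) w = conj (atomicType σ (V w))
                  (conj (⋀ (successors F w) (◇ ∘ char m))
                        (box (⋁ (successors F w) (char m))))

  char-occurs : ∀ m {w} → Occurs p (char m w) → p ∈ σ
  char-occurs zero    o         = atomicType-occurs o
  char-occurs (suc m) (conjˡ o) = atomicType-occurs o
  char-occurs (suc m) {w} (conjʳ (conjˡ o)) with ⋀-occurs (successors F w) o
  ... | _ , _ , neg′ (box′ (neg′ o′)) = char-occurs m o′
  char-occurs (suc m) {w} (conjʳ (conjʳ (box′ o))) with ⋁-occurs (successors F w) o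
  ... | _ , _ , o′ = char-occurs m o′

  module _ where

    open Semantics F V

    char-holds : ∀ m w → sat F V w (char m w)
    char-holds zero    w = from sat-atomicType λ _ → refl
    char-holds (suc m) w = from sat-atomicType (λ _ → refl)
                         , ⋀-intro (successors F w) (λ v∈ → ◇-intro (∈-successors⁻ v∈) (char-holds m _))
                         , λ v wRv → ⋁-intro (successors F w) (∈-successors⁺ wRv) (char-holds m v)

  module _ {G : Frame} (W : Valuation G) where

    open Approximation σ F V G W
    open Semantics G W

    char-sound : ∀ m {w x} → sat G W x (char m w) → w ∼[ m ] x
    char-sound zero    τ = sym ∘ to sat-atomicType τ
    char-sound (suc m) {w} {x} (τ , ◇successors , □successors) =
      sym ∘ to sat-atomicType τ , forth , back
      where
      forth : ∀ v → R F w v ≡ true → ∃[ y ] R G x y ≡ true × v ∼[ m ] y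
      forth v wRv = let y , xRy , c = ◇-elim (⋀-elim (successors F w) ◇successors (∈-successors⁺ wRv))
                    in y , xRy , char-sound m c
      back : ∀ y → R G x y ≡ true → ∃[ v ] R F w v ≡ true × v ∼[ m ] y
      back y xRy = let v , v∈ , c = ⋁-elim (successors F w) (□successors y xRy)
                   in v , ∈-successors⁻ v∈ , char-sound m c

transport-consequence : {F₁ F₂ : Frame} {V : Valuation F₁} {W : Valuation F₂} →
                        (∀ V′ → sat F₁ V′ zero (φ ⇒ ψ)) → (∀ {p} → p ∈ sig φ → p ∈ sig ψ → p ∈ σ) →
                        ReductIso σ F₁ V zero F₂ W zero → sat F₁ V zero φ → sat F₂ W zero ψ
transport-consequence {φ = φ} {ψ = ψ} {F₁ = F₁} {F₂ = F₂} {V = V} {W = W} valid shared iso φ-holds =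
  to (sat-bisim-invariant (graph-isBisim (ReductIso⇒IsPMorphism iso) V*-agrees-ψ) ψ ∈-sig⁺ point)
     (Semantics.⇒-elim F₁ V* {φ = φ} {ψ = ψ} (valid V*) (from (sat-agree V*-agrees-φ ∈-sig⁺) φ-holds))
  where
  open ReductIso iso
  h : World F₁ → World F₂
  h = Bijection.to f
  V* : Valuation F₁
  V* w p with p ∈? sig φ
  ... | yes _ = V w p
  ... | no  _ = W (h w) p
  V*-agrees-φ : ∀ w {p} → p ∈ sig φ → V* w p ≡ V w p
  V*-agrees-φ w {p} p∈φ with p ∈? sig φ
  ... | yes _   = refl
  ... | no  p∉φ = contradiction p∈φ p∉φ
  V*-agrees-ψ : ∀ w {p} → p ∈ sig ψ → V* w p ≡ W (h w) p
  V*-agrees-ψ w {p} p∈ψ with p ∈? sig φ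
  ... | yes p∈φ = atoms w p (shared p∈φ p∈ψ)
  ... | no  _   = refl

module Interpolant {n} (Fs : Fin n → Frame) (φ ψ : Fm) where

  common : List ℕ
  common = filter (_∈? sig ψ) (sig φ)

  ∈-common⁺ : p ∈ sig φ → p ∈ sig ψ → p ∈ common
  ∈-common⁺ = ∈-filter⁺ (_∈? sig ψ)

  ∈-common⁻ : p ∈ common → p ∈ sig φ × p ∈ sig ψ
  ∈-common⁻ = ∈-filter⁻ (_∈? sig ψ) {xs = sig φ}

  models : (k : Fin n) → List (Valuation (Fs k))
  models k = filter (λ V → sat? (Fs k) V zero φ) (valuations (Fs k) (sig φ))

  ∈-models⁺ : ∀ {k V} → V ∈ valuations (Fs k) (sig φ) → sat (Fs k) V zero φ → V ∈ models k
  ∈-models⁺ {k} = ∈-filter⁺ (λ V → sat? (Fs k) V zero φ)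

  ∈-models⁻ : ∀ {k V} → V ∈ models k → sat (Fs k) V zero φ
  ∈-models⁻ {k} = proj₂ ∘ ∈-filter⁻ (λ V → sat? (Fs k) V zero φ) {xs = valuations (Fs k) (sig φ)}

  -- Bisimulation approximants between two frames of L stabilise within this many steps.
  depth : ℕ
  depth = suc (sizeBound Fs) * suc (sizeBound Fs)

  open Characteristic common

  χ-frame : Fin n → Fm
  χ-frame k = ⋁ (models k) λ V → char (Fs k) V depth zero

  χ : Fm
  χ = ⋁ (allFin n) χ-frame

  χ-shared : ∀ p → Occurs p χ → Occurs p φ × Occurs p ψ
  χ-shared p o with ⋁-occurs (allFin n) o
  ... | k , _ , o′ with ⋁-occurs (models k) o′
  ...   | V , _ , o″ = let p∈φ , p∈ψ = ∈-common⁻ (char-occurs (Fs k) V depth o″)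
                       in ∈-sig⁻ φ p∈φ , ∈-sig⁻ ψ p∈ψ

  φ⇒χ : Log Fs (φ ⇒ χ)
  φ⇒χ k W = ⇒-intro {φ = φ} {ψ = χ} λ φ-holds →
    let V , V∈ , V≈W = valuations-complete {F = Fs k} (sig φ) W
        φ-holds-V    = from (sat-agree V≈W ∈-sig⁺) φ-holds
        char-holds-W = to (sat-agree (λ w p∈ → V≈W w (proj₁ (∈-common⁻ p∈)))
                                     (char-occurs (Fs k) V depth))
                          (char-holds (Fs k) V depth zero)
    in ⋁-intro {f = χ-frame} (allFin n) (∈-allFin k)
         (⋁-intro (models k) (∈-models⁺ V∈ φ-holds-V) char-holds-W)
    where open Semantics (Fs k) W

  χ⇒ψ : Condition2 Fs → Log Fs (φ ⇒ ψ) → Log Fs (χ ⇒ ψ)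
  χ⇒ψ condition2 valid k W = ⇒-intro {φ = χ} {ψ = ψ} λ χ-holds →
    let i , _ , χᵢ-holds        = ⋁-elim {f = χ-frame} (allFin n) χ-holds
        V , V∈ , char-holds-W = ⋁-elim (models i) χᵢ-holds
        bisimilar = Approximation.∼-deep⇒bisimilar common (Fs i) V (Fs k) W depth-bound
                      (char-sound (Fs i) V W depth char-holds-W)
    in transport-consequence (valid i) ∈-common⁺ (condition2 common i k V W bisimilar) (∈-models⁻ V∈)
    where
    open Semantics (Fs k) W
    depth-bound : ∀ {i} → suc (size (Fs i)) * suc (size (Fs k)) ≤ depth
    depth-bound {i} = *-mono-≤ (s≤s (size≤sizeBound Fs i)) (s≤s (size≤sizeBound Fs k))

condition2⇒cip : {Fs : Fin n → Frame} → Condition2 Fs → CIP (Log Fs)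
condition2⇒cip {Fs = Fs} condition2 φ ψ valid = χ , φ⇒χ , χ⇒ψ condition2 valid , χ-shared
  where open Interpolant Fs φ ψ

theorem5p1 : (n : ℕ) (Fs : Fin n → Frame) → Reduced Fs →
    CIP (Log Fs) ⇔ Condition2 Fs
theorem5p1 n Fs reduced = mk⇔ (cip⇒condition2 reduced) condition2⇒cip
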